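{- Let $\mathcal{D}_h,\mathcal{D}_l$ be NDBATs, $m$ an NDBAT refinement mapping from $\mathcal{D}_h$ to $\mathcal{D}_l$ proper wrt $\mathcal{D}_l$, $M_h\models\mathcal{D}_h\cup\mathcal{C}$, $M_l\models\mathcal{D}_l\cup\mathcal{C}$, and suppose $M_h\sim_m M_l$. Then for any sequence $\vec\alpha$ of high-level system actions and any variable assignment $v$: (1) if $M_l,v[s/s_l]\models Do(m_s(\vec\alpha),S_0,s)$, then there exists $s_h$ such that $M_h,v[s/s_h]\models s=do(\vec\alpha,S_0)\wedge Executable(s)$ and $s_h\sim_m^{M_h,M_l}s_l$; and (2) if $M_h,v[s/s_h]\models s=do(\vec\alpha,S_0)\wedge Executable(s)$, then $M_l,v\models\exists s.Do(m_s(\vec\alpha),S_0,s)$ and for all $s_l$ such that $M_l,v[s/s_l]\models Do(m_s(\vec\alpha),S_0,s)$ we have $s_h\sim_m^{M_h,M_l}s_l$.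
   Context: Framework: the situation calculus. Situations: $S_0$ and $do(a,s)$; $do([a_1,\dots,a_n],s)$ abbreviates $do(a_n,\dots do(a_1,s)\dots)$. $Executable(s)$ means every action performed in reaching $s$ was possible ($Poss$) when performed. $M,v\models\phi$: model $M$ and variable assignment $v$ satisfy $\phi$; $v[x/d]$ is $v$ modified to send $x$ to $d$. The sequence $\vec\alpha$ may contain free variables in action parameters (interpreted by $v$), but its action function symbols are given. NDBAT: a basic action theory (foundational axioms, initial-state axioms, unique-name axioms for actions, successor state axioms, precondition axioms $Poss(A(\vec x,e),s)\equiv\phi^{Poss}_A(\vec x,e,s)$) in which every action function $A(\vec x,e)$ has a final argument $e$ of sort Reaction. $A(\vec x,e)$ is a system action, $A(\vec x)$ the agent action, with agent precondition $Poss_{ag}(A(\vec x),s)$; the theory entails $\forall e.Poss(A(\vec x,e),s)\supset Poss_{ag}(A(\vec x),s)$ and $Poss_{ag}(A(\vec x),s)\supset\exists e.Poss(A(\vec x,e),s)$. ConGolog programs $\delta::=\alpha\mid\varphi?\mid\delta_1;\delta_2\mid\delta_1|\delta_2\mid\pi x.\delta\mid\delta^*\mid\delta_1\|\delta_2$ ($nil=True?$). $\mathcal{C}$ axiomatizes $Trans,Final$: $Trans(\alpha,s,\delta',s')\equiv s'=do(\alpha,s)\wedge Poss(\alpha,s)\wedge\delta'=True?$; $Trans(\varphi?,s,\delta',s')\equiv False$; $Trans(\delta_1;\delta_2,s,\delta',s')\equiv(Trans(\delta_1,s,\delta_1',s')\wedge\delta'=\delta_1';\delta_2)\vee(Final(\delta_1,s)\wedge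 Trans(\delta_2,s,\delta',s'))$; choice: disjunction; $\pi$: existential; $Trans(\delta^*,s,\delta',s')\equiv Trans(\delta,s,\delta'',s')\wedge\delta'=\delta'';\delta^*$; $\|$: interleaving. $Final(\alpha,s)\equiv False$, $Final(\varphi?,s)\equiv\varphi[s]$, sequence and $\|$: conjunction, choice: disjunction, $\pi$: existential, $Final(\delta^*,s)\equiv True$. $Do(\delta,s,s')\doteq\exists\delta'.Trans^*(\delta,s,\delta',s')\wedge Final(\delta',s')$. Agent programs (atoms are agent actions) use $Trans(A(\vec x),s,\delta',s')\equiv\exists e.Poss(A(\vec x,e),s)\wedge\delta'=True?\wedge s'=do(A(\vec x,e),s)$; $Do_{ag}$ is $Do$ under this semantics. SD (situation-determined): $Trans^*(\delta,s,\delta',s')\wedge Trans^*(\delta,s,\delta'',s')\supset\delta'=\delta''$. Abstraction setting: high-level NDBAT $\mathcal{D}_h$ (finite action types $\mathcal{A}_h$, fluents $\mathcal{F}_h$), low-level NDBAT $\mathcal{D}_l$, sharing only a countably infinite set of standard object names (unique names, domain closure; Reaction a subsort of Object); no functions other than constants, no non-fluent predicates. A refinement mapping $m=\langle m_a,m_s,m_f\rangle$ maps each $A\in\mathcal{A}_h$ to an SD low-level agent program $m_a(A(\vec x))$ and an SD low-level system program $m_s(A(\vec x,e))$, and each high-level fluent $F(\vec x)$ to a situation-suppressed low-level formula $m_f(F(\vec x))$; extended to sequences by composition with ";" ($m(\epsilon)=nil$). Proper wrt $\mathcal{D}_l$: for all high-level system action sequences $\vec\alpha$ and $A$, $\mathcal{D}_l\cup\mathcal{C}\models\forall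 s.(Do(m_s(\vec\alpha),S_0,s)\supset\forall\vec x,s'.(Do_{ag}(m_a(A(\vec x)),s,s')\equiv\exists e.Do(m_s(A(\vec x,e)),s,s')))$. $s_h\sim_m^{M_h,M_l}s_l$ iff for every $F\in\mathcal{F}_h$ and assignment $v$: $M_h,v[s/s_h]\models F(\vec x,s)$ iff $M_l,v[s/s_l]\models m_f(F(\vec x))[s]$. An $m$-bisimulation $B$ satisfies, for $\langle s_h,s_l\rangle\in B$: (i) $s_h\sim_m^{M_h,M_l}s_l$; (ii) for each $A\in\mathcal{A}_h$, if $M_h,v[s/s_h,s'/s_h']\models Poss(A(\vec x,e),s)\wedge s'=do(A(\vec x,e),s)$ then some $s_l'$ has $M_l,v[s/s_l,s'/s_l']\models Do(m_s(A(\vec x,e)),s,s')$ and $\langle s_h',s_l'\rangle\in B$; (iii) conversely from $Do(m_s(A(\vec x,e)),s_l,s_l')$ to some $s_h'=do(A(\vec x,e),s_h)$ with $Poss$ and $\langle s_h',s_l'\rangle\in B$. $M_h\sim_m M_l$ iff some $m$-bisimulation relates $S_0^{M_h}$ and $S_0^{M_l}$. -}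

module Defs where

open import Data.Nat using (ℕ; zero; suc)
open import Data.Fin using (Fin; zero; suc)
open import Data.Vec using (Vec; []; _∷_; lookup)
open import Data.List using (List; []; _∷_)
open import Data.List.Relation.Unary.All using (All)
open import Data.Product using (Σ; _×_; _,_; ∃)
open import Data.Sum using (_⊎_)
open import Data.Empty using (⊥)
open import Data.Unit using (⊤)
open import Function.Bundles using (_⇔_; _↔_)
open import Relation.Binary.PropositionalEquality using (_≡_)

-- Standard object names are the natural numbers (countably infinite,
-- unique names + domain closure).  The sort Reaction is a subsort of
-- Object; which names are of sort Reaction is given by a predicate
-- Rn : ℕ → Set shared by both theories.

-- Signatures of an NDBAT: action types A (with the number of object
-- arguments x⃗, the final Reaction argument e is implicit) and fluents.

record Signature : Set₁ where
  field
    ActType : Set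
    arity   : ActType → ℕ
    Fluent  : Set
    farity  : Fluent → ℕ
open Signature public

module _ (S : Signature) where

  data Act : Set where
    act : (A : ActType S) → Vec ℕ (arity S A) → (e : ℕ) → Act

  Sit : Set
  Sit = List Act

  record Structure : Set₁ where
    field
      Poss   : Act → Sit → Set
      PossAg : (A : ActType S) → Vec ℕ (arity S A) → Sit → Set
      Holds  : (F : Fluent S) → Vec ℕ (farity S F) → Sit → Set
  open Structure public

  -- a theory D (foundational axioms, initial state, SSAs, precondition
  -- axioms, ...) is identified with its class of models
  Theory : Set₂
  Theory = Structure → Set₁

S₀ : {S : Signature} → Sit S
S₀ = []

doA : {S : Signature} → Act S → Sit S → Sit S
doA a s = a ∷ s

doSeq : {S : Signature} → List (Act S) → Sit S → Sit S
doSeq []       s = s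
doSeq (a ∷ as) s = doSeq as (doA a s)

Executable : {S : Signature} → Structure S → Sit S → Set
Executable M []       = ⊤
Executable M (a ∷ s)  = Executable M s × Poss M a s

SysAct : (Rn : ℕ → Set) {S : Signature} → Act S → Set
SysAct Rn (act A xs e) = Rn e

NDBAT : (Rn : ℕ → Set) (S : Signature) → Theory S → Set₁
NDBAT Rn S T = (M : Structure S) → T M →
  (A : ActType S) (xs : Vec ℕ (arity S A)) (s : Sit S) →
    (((e : ℕ) → Rn e → Poss M (act A xs e) s) → PossAg M A xs s)
  × (PossAg M A xs s → Σ ℕ λ e → Rn e × Poss M (act A xs e) s)

-- Terms and situation-suppressed first-order formulas, n free
-- object variables (de Bruijn, Fin n)

data Tm (n : ℕ) : Set where
  var : Fin n → Tm n
  con : ℕ → Tm n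

data Kind : Set where
  sys ag : Kind

-- reaction argument of an atomic action: present for system programs,
-- absent for agent programs
RTm : Kind → ℕ → Set
RTm sys n = Tm n
RTm ag  n = ⊤

module _ (S : Signature) where

  data Fm (n : ℕ) : Set where
    true false : Fm n
    atom  : (F : Fluent S) → Vec (Tm n) (farity S F) → Fm n
    eq    : Tm n → Tm n → Fm n
    react : Tm n → Fm n
    neg   : Fm n → Fm n
    and or imp : Fm n → Fm n → Fm n
    ex all : Fm (suc n) → Fm n

  data Prog (k : Kind) (n : ℕ) : Set where
    act  : (A : ActType S) → Vec (Tm n) (arity S A) → RTm k n → Prog k n
    test : Fm n → Prog k n
    seq  : Prog k n → Prog k n → Prog k n
    choice : Prog k n → Prog k n → Prog k n
    pick : Prog k (suc n) → Prog k n
    star : Prog k n → Prog k n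
    conc : Prog k n → Prog k n → Prog k n


nil : {S : Signature} {k : Kind} {n : ℕ} → Prog S k n
nil = test (true)

evalTm : {n : ℕ} → Vec ℕ n → Tm n → ℕ
evalTm ρ (var i) = lookup ρ i
evalTm ρ (con c) = c

evalTms : {n m : ℕ} → Vec ℕ n → Vec (Tm n) m → Vec ℕ m
evalTms ρ []       = []
evalTms ρ (t ∷ ts) = evalTm ρ t ∷ evalTms ρ ts

Sat : (Rn : ℕ → Set) {S : Signature} → Structure S → {n : ℕ} →
      Fm S n → Vec ℕ n → Sit S → Set
Sat Rn M true        ρ s = ⊤
Sat Rn M false       ρ s = ⊥
Sat Rn {S} M (atom F ts) ρ s = Holds M F (evalTms ρ ts) s
Sat Rn M (eq t u)    ρ s = evalTm ρ t ≡ evalTm ρ u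
Sat Rn M (react t)   ρ s = Rn (evalTm ρ t)
Sat Rn M (neg φ)     ρ s = Sat Rn M φ ρ s → ⊥
Sat Rn M (and φ ψ)   ρ s = Sat Rn M φ ρ s × Sat Rn M ψ ρ s
Sat Rn M (or φ ψ)    ρ s = Sat Rn M φ ρ s ⊎ Sat Rn M ψ ρ s
Sat Rn M (imp φ ψ)   ρ s = Sat Rn M φ ρ s → Sat Rn M ψ ρ s
Sat Rn M (ex φ)      ρ s = Σ ℕ λ d → Sat Rn M φ (d ∷ ρ) s
Sat Rn M (all φ)     ρ s = (d : ℕ) → Sat Rn M φ (d ∷ ρ) s

Subst : ℕ → ℕ → Set
Subst n m = Fin n → Tm m

wkTm : {m : ℕ} → Tm m → Tm (suc m)
wkTm (var i) = var (suc i)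
wkTm (con c) = con c

lift : {n m : ℕ} → Subst n m → Subst (suc n) (suc m)
lift σ zero    = var zero
lift σ (suc i) = wkTm (σ i)

subTm : {n m : ℕ} → Subst n m → Tm n → Tm m
subTm σ (var i) = σ i
subTm σ (con c) = con c

subTms : {n m k : ℕ} → Subst n m → Vec (Tm n) k → Vec (Tm m) k
subTms σ []       = []
subTms σ (t ∷ ts) = subTm σ t ∷ subTms σ ts

subFm : {S : Signature} {n m : ℕ} → Subst n m → Fm S n → Fm S m
subFm σ true        = true
subFm σ false       = false
subFm σ (atom F ts) = atom F (subTms σ ts)
subFm σ (eq t u)    = eq (subTm σ t) (subTm σ u)
subFm σ (react t)   = react (subTm σ t)
subFm σ (neg φ)     = neg (subFm σ φ)
subFm σ (and φ ψ)   = and (subFm σ φ) (subFm σ ψ)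
subFm σ (or φ ψ)    = or (subFm σ φ) (subFm σ ψ)
subFm σ (imp φ ψ)   = imp (subFm σ φ) (subFm σ ψ)
subFm σ (ex φ)      = ex (subFm (lift σ) φ)
subFm σ (all φ)     = all (subFm (lift σ) φ)

subR : {k : Kind} {n m : ℕ} → Subst n m → RTm k n → RTm k m
subR {k = sys} σ t  = subTm σ t
subR {k = ag}  σ r = r

subProg : {S : Signature} {k : Kind} {n m : ℕ} → Subst n m → Prog S k n → Prog S k m
subProg {k = k} σ (act A ts r) = act A (subTms σ ts) (subR {k = k} σ r)
subProg σ (test φ)       = test (subFm σ φ)
subProg σ (seq δ γ)      = seq (subProg σ δ) (subProg σ γ)
subProg σ (choice δ γ)   = choice (subProg σ δ) (subProg σ γ)
subProg σ (pick δ)       = pick (subProg (lift σ) δ)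
subProg σ (star δ)       = star (subProg σ δ)
subProg σ (conc δ γ)     = conc (subProg σ δ) (subProg σ γ)

inst0 : {S : Signature} {k : Kind} {n : ℕ} → ℕ → Prog S k (suc n) → Prog S k n
inst0 d δ = subProg σ δ
  where
    σ : Subst _ _
    σ zero    = con d
    σ (suc i) = var i

close : {S : Signature} {k : Kind} {n : ℕ} → Vec ℕ n → Prog S k n → Prog S k 0
close ρ δ = subProg (λ i → con (lookup ρ i)) δ

-- The ConGolog axioms C: Trans and Final (for closed programs), for
-- both the system-program semantics and the agent-program semantics

module Semantics (Rn : ℕ → Set) {S : Signature} (M : Structure S) where

  Cl : Kind → Set
  Cl k = Prog S k 0

  data Final {k : Kind} : Cl k → Sit S → Set where
    f-test   : ∀ {φ s} → Sat Rn M φ [] s → Final (test φ) s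
    f-seq    : ∀ {δ γ s} → Final δ s → Final γ s → Final (seq δ γ) s
    f-choiceˡ : ∀ {δ γ s} → Final δ s → Final (choice δ γ) s
    f-choiceʳ : ∀ {δ γ s} → Final γ s → Final (choice δ γ) s
    f-pick   : ∀ {δ s} (d : ℕ) → Final (inst0 d δ) s → Final (pick δ) s
    f-star   : ∀ {δ s} → Final (star δ) s
    f-conc   : ∀ {δ γ s} → Final δ s → Final γ s → Final (conc δ γ) s

  data Trans : (k : Kind) → Cl k → Sit S → Cl k → Sit S → Set where
    t-sys    : ∀ {A ts e s} →
               Rn (evalTm [] e) →
               Poss M (act A (evalTms [] ts) (evalTm [] e)) s →
               Trans sys (act A ts e) s nil (doA (act A (evalTms [] ts) (evalTm [] e)) s)
    t-ag     : ∀ {A ts r s} (e : ℕ) → Rn e →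
               Poss M (act A (evalTms [] ts) e) s →
               Trans ag (act A ts r) s nil (doA (act A (evalTms [] ts) e) s)
    t-seqˡ   : ∀ {k δ γ s δ' s'} → Trans k δ s δ' s' → Trans k (seq δ γ) s (seq δ' γ) s'
    t-seqʳ   : ∀ {k δ γ s γ' s'} → Final δ s → Trans k γ s γ' s' → Trans k (seq δ γ) s γ' s'
    t-choiceˡ : ∀ {k δ γ s δ' s'} → Trans k δ s δ' s' → Trans k (choice δ γ) s δ' s'
    t-choiceʳ : ∀ {k δ γ s γ' s'} → Trans k γ s γ' s' → Trans k (choice δ γ) s γ' s'
    t-pick   : ∀ {k δ s δ' s'} (d : ℕ) → Trans k (inst0 d δ) s δ' s' → Trans k (pick δ) s δ' s'
    t-star   : ∀ {k δ s δ' s'} → Trans k δ s δ' s' → Trans k (star δ) s (seq δ' (star δ)) s'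
    t-concˡ  : ∀ {k δ γ s δ' s'} → Trans k δ s δ' s' → Trans k (conc δ γ) s (conc δ' γ) s'
    t-concʳ  : ∀ {k δ γ s γ' s'} → Trans k γ s γ' s' → Trans k (conc δ γ) s (conc δ γ') s'

  data Trans* (k : Kind) : Cl k → Sit S → Cl k → Sit S → Set where
    ε   : ∀ {δ s} → Trans* k δ s δ s
    _◅_ : ∀ {δ s δ₁ s₁ δ' s'} → Trans k δ s δ₁ s₁ → Trans* k δ₁ s₁ δ' s' → Trans* k δ s δ' s'

  Do : (k : Kind) → Cl k → Sit S → Sit S → Set
  Do k δ s s' = Σ (Cl k) λ δ' → Trans* k δ s δ' s' × Final δ' s'

  SDin : (k : Kind) → Cl k → Sit S → Set
  SDin k δ s = ∀ {δ' δ'' s'} → Trans* k δ s δ' s' → Trans* k δ s δ'' s' → δ' ≡ δ''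

Finite : Set → Set
Finite X = Σ ℕ λ k → X ↔ Fin k

module _ (Rn : ℕ → Set) (Sh Sl : Signature) where

  record RefinementMapping : Set where
    field
      mₐ : (A : ActType Sh) → Prog Sl (ag) (arity Sh A)
      -- m_s(A(x⃗,e)) : low-level system program, free vars e ∷ x⃗ (var 0 = e)
      mₛ : (A : ActType Sh) → Prog Sl (sys) (suc (arity Sh A))
      m𝒻 : (F : Fluent Sh) → Fm Sl (farity Sh F)
  open RefinementMapping public

  mₛAct : RefinementMapping → Act Sh → Prog Sl sys 0
  mₛAct m (act A xs e) = close (e ∷ xs) (mₛ m A)

  mₛSeq : RefinementMapping → List (Act Sh) → Prog Sl sys 0
  mₛSeq m []       = nil
  mₛSeq m (α ∷ αs) = seq (mₛAct m α) (mₛSeq m αs)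

  SDMapping : Theory Sl → RefinementMapping → Set₁
  SDMapping Tl m = (Ml : Structure Sl) → Tl Ml → (A : ActType Sh) →
      ((xs : Vec ℕ (arity Sh A)) (s : Sit Sl) →
         Semantics.SDin Rn Ml ag (close xs (mₐ m A)) s)
    × ((xs : Vec ℕ (arity Sh A)) (e : ℕ) → Rn e → (s : Sit Sl) →
         Semantics.SDin Rn Ml sys (close (e ∷ xs) (mₛ m A)) s)

  Proper : Theory Sl → RefinementMapping → Set₁
  Proper Tl m = (Ml : Structure Sl) → Tl Ml →
    (αs : List (Act Sh)) → All (SysAct Rn) αs → (A : ActType Sh) →
    (s : Sit Sl) → Semantics.Do Rn Ml sys (mₛSeq m αs) S₀ s →
    (xs : Vec ℕ (arity Sh A)) (s' : Sit Sl) →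
      Semantics.Do Rn Ml ag (close xs (mₐ m A)) s s'
        ⇔ (Σ ℕ λ e → Rn e × Semantics.Do Rn Ml sys (close (e ∷ xs) (mₛ m A)) s s')

  MEquiv : RefinementMapping → Structure Sh → Structure Sl → Sit Sh → Sit Sl → Set
  MEquiv m Mh Ml sh sl = (F : Fluent Sh) (xs : Vec ℕ (farity Sh F)) →
    Holds Mh F xs sh ⇔ Sat Rn Ml (m𝒻 m F) xs sl

  IsBisim : RefinementMapping → Structure Sh → Structure Sl →
            (Sit Sh → Sit Sl → Set) → Set
  IsBisim m Mh Ml B = (sh : Sit Sh) (sl : Sit Sl) → B sh sl →
      MEquiv m Mh Ml sh sl
    × ((A : ActType Sh) (xs : Vec ℕ (arity Sh A)) (e : ℕ) → Rn e →
         Poss Mh (act A xs e) sh →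
         Σ (Sit Sl) λ sl' → Semantics.Do Rn Ml sys (close (e ∷ xs) (mₛ m A)) sl sl'
                           × B (doA (act A xs e) sh) sl')
    × ((A : ActType Sh) (xs : Vec ℕ (arity Sh A)) (e : ℕ) → Rn e →
         (sl' : Sit Sl) → Semantics.Do Rn Ml sys (close (e ∷ xs) (mₛ m A)) sl sl' →
         Poss Mh (act A xs e) sh × B (doA (act A xs e) sh) sl')

  Bisimilar : RefinementMapping → Structure Sh → Structure Sl → Set₁
  Bisimilar m Mh Ml = Σ (Sit Sh → Sit Sl → Set) λ B →
    IsBisim m Mh Ml B × B S₀ S₀

module Submission where

open import Defs
open import Data.Nat using (ℕ)
open import Data.List using (List; []; _∷_)
open import Data.List.Relation.Unary.All using (All; []; _∷_)
open import Data.Product using (Σ; _×_; _,_; proj₁; proj₂)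
open import Data.Unit using (tt)
open import Relation.Binary.PropositionalEquality using (_≡_; refl)

-- A bisimulation B relates the initial situations; induction along α⃗ then
-- transports B through each block m_s(α): clause (iii) turns a low-level
-- execution of m_s(α) into an executable high-level step, clause (ii) turns
-- an executable high-level step into some low-level execution of m_s(α).
-- Fluent agreement at the end is clause (i).

module SequentialComposition (Rn : ℕ → Set) {S : Signature} (M : Structure S) where
  open Semantics Rn M

  Do-nil⇒≡ : ∀ {s s'} → Do sys nil s s' → s ≡ s'
  Do-nil⇒≡ (_ , ε , _)      = refl
  Do-nil⇒≡ (_ , () ◅ _ , _)

  Do-seq-split : ∀ {δ γ : Cl sys} {s s'} → Do sys (seq δ γ) s s' →
                 Σ (Sit S) λ s₁ → Do sys δ s s₁ × Do sys γ s₁ s'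
  Do-seq-split (_ , ε , f-seq fδ fγ)          = _ , (_ , ε , fδ) , (_ , ε , fγ)
  Do-seq-split (_ , t-seqʳ fδ t ◅ r , f)      = _ , (_ , ε , fδ) , (_ , t ◅ r , f)
  Do-seq-split (_ , t-seqˡ t ◅ r , f)
    with Do-seq-split (_ , r , f)
  ... | s₁ , (δ₁ , r₁ , f₁) , dγ = s₁ , (δ₁ , t ◅ r₁ , f₁) , dγ

  Do-seq-join : ∀ {δ γ : Cl sys} {s s₁ s'} → Do sys δ s s₁ → Do sys γ s₁ s' →
                Do sys (seq δ γ) s s'
  Do-seq-join (_ , ε , fδ) (_ , ε , fγ)     = _ , ε , f-seq fδ fγ
  Do-seq-join (_ , ε , fδ) (_ , t ◅ r , fγ) = _ , t-seqʳ fδ t ◅ r , fγ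
  Do-seq-join (_ , t ◅ r , fδ) dγ
    with Do-seq-join (_ , r , fδ) dγ
  ... | δ' , r' , f' = δ' , t-seqˡ t ◅ r' , f'

Executable-doSeq⇒Executable : {S : Signature} (M : Structure S) (αs : List (Act S))
  (s : Sit S) → Executable M (doSeq αs s) → Executable M s
Executable-doSeq⇒Executable M []       s exec = exec
Executable-doSeq⇒Executable M (α ∷ αs) s exec =
  proj₁ (Executable-doSeq⇒Executable M αs (α ∷ s) exec)

module BisimulationAlongSequences (Rn : ℕ → Set) (Sh Sl : Signature)
  (m : RefinementMapping Rn Sh Sl) (Mh : Structure Sh) (Ml : Structure Sl)
  (B : Sit Sh → Sit Sl → Set) (isBisim : IsBisim Rn Sh Sl m Mh Ml B) where
  open Semantics Rn Ml
  open SequentialComposition Rn Ml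

  low-run⇒high-run : (αs : List (Act Sh)) → All (SysAct Rn) αs →
    ∀ {sh sl sl'} → B sh sl → Executable Mh sh → Do sys (mₛSeq Rn Sh Sl m αs) sl sl' →
    Executable Mh (doSeq αs sh) × B (doSeq αs sh) sl'
  low-run⇒high-run [] [] b exec d with Do-nil⇒≡ d
  ... | refl = exec , b
  low-run⇒high-run (act A xs e ∷ αs) (re ∷ res) {sh} {sl} b exec d
    with Do-seq-split d
  ... | sl₁ , dα , dαs
    with proj₂ (proj₂ (isBisim sh sl b)) A xs e re sl₁ dα
  ... | poss , b₁ = low-run⇒high-run αs res b₁ (exec , poss) dαs

  high-run⇒low-run : (αs : List (Act Sh)) → All (SysAct Rn) αs →
    ∀ {sh sl} → B sh sl → Executable Mh (doSeq αs sh) →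
    Σ (Sit Sl) λ sl' → Do sys (mₛSeq Rn Sh Sl m αs) sl sl'
  high-run⇒low-run [] [] {sl = sl} b exec = sl , nil , ε , f-test tt
  high-run⇒low-run (act A xs e ∷ αs) (re ∷ res) {sh} {sl} b exec
    with proj₁ (proj₂ (isBisim sh sl b)) A xs e re
           (proj₂ (Executable-doSeq⇒Executable Mh αs _ exec))
  ... | sl₁ , dα , b₁
    with high-run⇒low-run αs res b₁ exec
  ... | sl' , dαs = sl' , Do-seq-join dα dαs

lemma2 : (Rn : ℕ → Set) (Sh Sl : Signature) →
    Finite (ActType Sh) → Finite (Fluent Sh) →
    (Th : Theory Sh) (Tl : Theory Sl) → NDBAT Rn Sh Th → NDBAT Rn Sl Tl →
    (m : RefinementMapping Rn Sh Sl) → SDMapping Rn Sh Sl Tl m →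
    Proper Rn Sh Sl Tl m →
    (Mh : Structure Sh) → Th Mh → (Ml : Structure Sl) → Tl Ml →
    Bisimilar Rn Sh Sl m Mh Ml →
    (αs : List (Act Sh)) → All (SysAct Rn) αs →
      ((sl : Sit Sl) → Semantics.Do Rn Ml sys (mₛSeq Rn Sh Sl m αs) S₀ sl →
         Σ (Sit Sh) λ sh → sh ≡ doSeq αs S₀ × Executable Mh sh
                          × MEquiv Rn Sh Sl m Mh Ml sh sl)
    × ((sh : Sit Sh) → sh ≡ doSeq αs S₀ × Executable Mh sh →
         (Σ (Sit Sl) λ sl → Semantics.Do Rn Ml sys (mₛSeq Rn Sh Sl m αs) S₀ sl)
       × ((sl : Sit Sl) → Semantics.Do Rn Ml sys (mₛSeq Rn Sh Sl m αs) S₀ sl →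
            MEquiv Rn Sh Sl m Mh Ml sh sl))
lemma2 Rn Sh Sl _ _ _ _ _ _ m _ _ Mh _ Ml _ (B , isBisim , b₀) αs res =
  high-from-low , λ { _ (refl , exec) → high-run⇒low-run αs res b₀ exec , agree }
  where
    open BisimulationAlongSequences Rn Sh Sl m Mh Ml B isBisim

    agree : ∀ sl → Semantics.Do Rn Ml sys (mₛSeq Rn Sh Sl m αs) S₀ sl →
            MEquiv Rn Sh Sl m Mh Ml (doSeq αs S₀) sl
    agree sl d = proj₁ (isBisim _ sl (proj₂ (low-run⇒high-run αs res b₀ tt d)))

    high-from-low : ∀ sl → Semantics.Do Rn Ml sys (mₛSeq Rn Sh Sl m αs) S₀ sl →
      Σ (Sit Sh) λ sh → sh ≡ doSeq αs S₀ × Executable Mh sh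
                       × MEquiv Rn Sh Sl m Mh Ml sh sl
    high-from-low sl d =
      doSeq αs S₀ , refl , proj₁ (low-run⇒high-run αs res b₀ tt d) , agree sl d
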